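{- Let $\mathbb{K}$ be a field, $V$ a two-dimensional $\mathbb{K}$-vector space, and $\mathcal{A}$ a finite set of distinct one-dimensional linear subspaces of $V$. Let $\mu,\nu\in\Lambda'$ with $\mu\mathrel{\dot\subset}\nu$ and $\nu_H=\mu_H+1$ for some $H\in\mathcal{A}$. Then, up to nonzero scalars, $\theta_\nu=\alpha_H\theta_\mu$ if $\Delta(\mu)>\Delta(\nu)$, and $\theta_\nu=\theta_\mu$ if $\Delta(\mu)<\Delta(\nu)$.
   Context: Let $S=\mathrm{Sym}(V^*)\cong\mathbb{K}[x,y]$, graded by polynomial degree; for $H\in\mathcal{A}$ fix $\alpha_H\in V^*$ with $\ker\alpha_H=H$. Let $\Lambda=\mathbb{N}^{|\mathcal{A}|}$, whose elements are multiplicities $\mu:\mathcal{A}\to\mathbb{N}$. For $\mu\in\Lambda$, $D(\mathcal{A},\mu)=\{\delta\in S\partial_x\oplus S\partial_y\mid \delta(\alpha_H)\in\alpha_H^{\mu_H}S\ \forall H\}$ is a free graded $S$-module of rank 2; if $(d_1,d_2)$ are the degrees of a homogeneous basis, $\Delta(\mu)=|d_1-d_2|$. $\mu\mathrel{\dot\subset}\nu$ means $\mu_H\le\nu_H$ for all $H$ and $\sum_H\nu_H=\sum_H\mu_H+1$. $\Lambda'=\Delta^{ -1}(\mathbb{Z}_{>0})$. For $\mu\in\Lambda'$, $\theta_\mu$ is the element of smaller degree in a homogeneous basis $\{\theta_\mu,\theta'_\mu\}$ of $D(\mathcal{A},\mu)$ with $\deg\theta_\mu<\deg\theta'_\mu$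 (unique up to nonzero scalar). -}

module Defs where

open import Level using (Level; _⊔_)
open import Algebra.Bundles using (CommutativeRing)
open import Data.Nat using (ℕ; zero; suc)
open import Data.Nat as N using ()
open import Data.Fin using (Fin)
import Data.Fin as Fin
open import Data.Product using (_×_; _,_; Σ; ∃; proj₁; proj₂)
open import Relation.Nullary using (¬_)
open import Relation.Binary.PropositionalEquality using (_≡_)

record Field (c ℓ : Level) : Set (Level.suc (c ⊔ ℓ)) where
  field
    commRing : CommutativeRing c ℓ
  open CommutativeRing commRing public
  field
    0≉1      : ¬ (0# ≈ 1#)
    inverse  : ∀ x → ¬ (x ≈ 0#) → Σ Carrier λ y → (x * y) ≈ 1#

-- Sum of natural numbers over Fin n (used for |μ| = Σ_H μ_H).
sumFin : (n : ℕ) → (Fin n → ℕ) → ℕ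
sumFin zero    f = 0
sumFin (suc n) f = f Fin.zero N.+ sumFin n (λ i → f (Fin.suc i))

module WithField {c ℓ : Level} (F : Field c ℓ) where
  open Field F

  -- Elements of K[[x,y]] as coefficient functions: p i j = coefficient of x^i y^j.
  -- Polynomials S = K[x,y] are those with finite support (IsPoly).
  Ser : Set c
  Ser = ℕ → ℕ → Carrier

  _≈ₚ_ : Ser → Ser → Set ℓ
  p ≈ₚ q = ∀ i j → p i j ≈ q i j

  IsPoly : Ser → Set ℓ
  IsPoly p = ∃ λ N → ∀ i j → N N.≤ (i N.+ j) → p i j ≈ 0#

  IsHomog : ℕ → Ser → Set ℓ
  IsHomog d p = ∀ i j → ¬ (i N.+ j ≡ d) → p i j ≈ 0#

  zeroₚ : Ser
  zeroₚ _ _ = 0#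

  oneₚ : Ser
  oneₚ zero zero = 1#
  oneₚ _    _    = 0#

  _+ₚ_ : Ser → Ser → Ser
  (p +ₚ q) i j = p i j + q i j

  _·ₚ_ : Carrier → Ser → Ser
  (a ·ₚ p) i j = a * p i j

  sumTo : ℕ → (ℕ → Carrier) → Carrier
  sumTo zero    f = f 0
  sumTo (suc n) f = f (suc n) + sumTo n f

  _*ₚ_ : Ser → Ser → Ser
  (p *ₚ q) i j = sumTo i (λ a → sumTo j (λ b → p a b * q (i N.∸ a) (j N.∸ b)))

  _^ₚ_ : Ser → ℕ → Ser
  p ^ₚ zero  = oneₚ
  p ^ₚ suc m = p *ₚ (p ^ₚ m)

  -- V = K², V* = K x ⊕ K y; a linear form is a pair (a , b) ↦ a x + b y.
  LinForm : Set c
  LinForm = Carrier × Carrier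

  linPoly : LinForm → Ser
  linPoly (a , b) (suc zero) zero = a
  linPoly (a , b) zero (suc zero) = b
  linPoly _       _    _          = 0#

  -- A line arrangement: n pairwise distinct lines H_i = ker α_i, α_i ≠ 0.
  record Arrangement (n : ℕ) : Set (c ⊔ ℓ) where
    field
      α        : Fin n → LinForm
      nonzero  : ∀ i → ¬ ((proj₁ (α i) ≈ 0#) × (proj₂ (α i) ≈ 0#))
      distinct : ∀ i j → ¬ (i ≡ j) →
                 ¬ ((proj₁ (α i) * proj₂ (α j)) ≈ (proj₁ (α j) * proj₂ (α i)))

  -- Derivations f ∂x + g ∂y with coefficients (f , g).
  Der : Set c
  Der = Ser × Ser

  _≈D_ : Der → Der → Set ℓ
  (f , g) ≈D (f' , g') = (f ≈ₚ f') × (g ≈ₚ g')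

  _+D_ : Der → Der → Der
  (f , g) +D (f' , g') = (f +ₚ f') , (g +ₚ g')

  _⊙_ : Ser → Der → Der
  h ⊙ (f , g) = (h *ₚ f) , (h *ₚ g)

  _·D_ : Carrier → Der → Der
  a ·D (f , g) = (a ·ₚ f) , (a ·ₚ g)

  zeroD : Der
  zeroD = zeroₚ , zeroₚ

  IsPolyDer : Der → Set ℓ
  IsPolyDer (f , g) = IsPoly f × IsPoly g

  IsHomogDer : ℕ → Der → Set ℓ
  IsHomogDer d (f , g) = IsHomog d f × IsHomog d g

  apply : Der → LinForm → Ser
  apply (f , g) (a , b) = (a ·ₚ f) +ₚ (b ·ₚ g)

  module _ {n : ℕ} (A : Arrangement n) where
    open Arrangement A

    InD : (Fin n → ℕ) → Der → Set (c ⊔ ℓ)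
    InD μ δ = IsPolyDer δ ×
              (∀ H → Σ Ser λ q → IsPoly q ×
                     (apply δ (α H) ≈ₚ ((linPoly (α H) ^ₚ μ H) *ₚ q)))

    record HomBasis (μ : Fin n → ℕ) (θ : Der) (d : ℕ) (θ' : Der) (d' : ℕ)
           : Set (c ⊔ ℓ) where
      field
        θ∈D       : InD μ θ
        θ'∈D      : InD μ θ'
        θ-homog   : IsHomogDer d θ
        θ'-homog  : IsHomogDer d' θ'
        generates : ∀ δ → InD μ δ →
                    Σ Ser λ f → Σ Ser λ g → IsPoly f × IsPoly g ×
                    (δ ≈D ((f ⊙ θ) +D (g ⊙ θ')))
        independent : ∀ f g → IsPoly f → IsPoly g →
                      ((f ⊙ θ) +D (g ⊙ θ')) ≈D zeroD →
                      (f ≈ₚ zeroₚ) × (g ≈ₚ zeroₚ)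

module Submission where

-- Write d < d' for the basis degrees of D(A, μ) and e < e' for those of
-- D(A, ν).  Two module maps drive the argument: D(A, ν) ⊆ D(A, μ) and
-- α_H · D(A, μ) ⊆ D(A, ν).  Since a homogeneous element of D(A, μ) of degree
-- below d' is a polynomial multiple of θ_μ (and vanishes below d), the first
-- inclusion gives d ≤ e and the second gives e ≤ d + 1.  In each of the two
-- cases one of the values e = d, e = d + 1 is excluded because it would give
-- a nontrivial polynomial relation between θ_ν and θ_ν' (resp. between θ_μ
-- and θ_μ'); the remaining value identifies θ_ν.

open import Defs
open import Level using (Level)
open import Data.Nat using (ℕ; zero; suc; _≤_; _<_; _∸_; z≤n; s≤s)
import Data.Nat as N
import Data.Nat.Properties as ℕ
open import Data.Fin using (Fin)
import Data.Fin as Fin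
open import Data.Product using (_×_; _,_; Σ; proj₁; proj₂)
open import Data.Empty using (⊥-elim)
open import Relation.Nullary using (¬_; yes; no)
open import Relation.Binary.Bundles using (Setoid)
open import Relation.Binary.PropositionalEquality as ≡ using (_≡_)

module Multiplicities where
  open N using (_+_)

  sum-mono : ∀ n (μ ν : Fin n → ℕ) → (∀ K → μ K ≤ ν K) → sumFin n μ ≤ sumFin n ν
  sum-mono zero    μ ν μ≤ν = z≤n
  sum-mono (suc n) μ ν μ≤ν =
    ℕ.+-mono-≤ (μ≤ν Fin.zero) (sum-mono n _ _ (λ K → μ≤ν (Fin.suc K)))

  sum-strict : ∀ n (μ ν : Fin n → ℕ) → (∀ K → μ K ≤ ν K) →
               ∀ K → μ K < ν K → sumFin n μ < sumFin n ν
  sum-strict (suc n) μ ν μ≤ν Fin.zero lt =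
    ℕ.+-mono-≤ lt (sum-mono n _ _ (λ K → μ≤ν (Fin.suc K)))
  sum-strict (suc n) μ ν μ≤ν (Fin.suc K) lt =
    ≡.subst (_≤ sumFin (suc n) ν) (ℕ.+-suc (μ Fin.zero) _)
      (ℕ.+-mono-≤ (μ≤ν Fin.zero) (sum-strict n _ _ (λ K → μ≤ν (Fin.suc K)) K lt))

  sum-strict₂ : ∀ n (μ ν : Fin n → ℕ) → (∀ K → μ K ≤ ν K) → ∀ H K → ¬ H ≡ K →
                μ H < ν H → μ K < ν K → 2 + sumFin n μ ≤ sumFin n ν
  sum-strict₂ (suc n) μ ν μ≤ν Fin.zero Fin.zero H≢K _ _ = ⊥-elim (H≢K ≡.refl)
  sum-strict₂ (suc n) μ ν μ≤ν Fin.zero (Fin.suc K) _ ltH ltK =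
    ≡.subst (_≤ sumFin (suc n) ν) (≡.cong suc (ℕ.+-suc (μ Fin.zero) _))
      (ℕ.+-mono-≤ ltH (sum-strict n _ _ (λ K → μ≤ν (Fin.suc K)) K ltK))
  sum-strict₂ (suc n) μ ν μ≤ν (Fin.suc H) Fin.zero _ ltH ltK =
    ≡.subst (_≤ sumFin (suc n) ν) (≡.cong suc (ℕ.+-suc (μ Fin.zero) _))
      (ℕ.+-mono-≤ ltK (sum-strict n _ _ (λ K → μ≤ν (Fin.suc K)) H ltH))
  sum-strict₂ (suc n) μ ν μ≤ν (Fin.suc H) (Fin.suc K) H≢K ltH ltK =
    ≡.subst (_≤ sumFin (suc n) ν)
      (≡.trans (ℕ.+-suc (μ Fin.zero) _) (≡.cong suc (ℕ.+-suc (μ Fin.zero) _)))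
      (ℕ.+-mono-≤ (μ≤ν Fin.zero)
        (sum-strict₂ n _ _ (λ K → μ≤ν (Fin.suc K)) H K (λ e → H≢K (≡.cong Fin.suc e)) ltH ltK))

  unchanged-off-H : ∀ n (μ ν : Fin n → ℕ) H → (∀ K → μ K ≤ ν K) →
                    sumFin n ν ≡ suc (sumFin n μ) → ν H ≡ suc (μ H) →
                    ∀ K → ¬ K ≡ H → ν K ≡ μ K
  unchanged-off-H n μ ν H μ≤ν sum-ν νH K K≢H with μ K N.≟ ν K
  ... | yes μK≡νK = ≡.sym μK≡νK
  ... | no  μK≢νK = ⊥-elim (ℕ.1+n≰n (≡.subst (2 + sumFin n μ ≤_) sum-ν
          (sum-strict₂ n μ ν μ≤ν H K (λ e → K≢H (≡.sym e))
            (ℕ.≤-reflexive (≡.sym νH)) (ℕ.≤∧≢⇒< (μ≤ν K) μK≢νK))))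

module Series {c ℓ : Level} (F : Field c ℓ) where
  open Field F
  open WithField F
  open import Relation.Binary.Reasoning.Setoid setoid
  open import Algebra.Properties.CommutativeSemigroup +-commutativeSemigroup
    using (interchange; x∙yz≈y∙xz)
  open import Algebra.Properties.CommutativeSemigroup *-commutativeSemigroup
    using () renaming (x∙yz≈y∙xz to x*yz≈y*xz)
  open import Algebra.Properties.CommutativeSemigroup ℕ.+-commutativeSemigroup
    using () renaming (interchange to ℕ-interchange)
  open import Algebra.Properties.Ring ring using (-1*x≈-x)

  sumTo-cong : ∀ n {f g : ℕ → Carrier} → (∀ a → a ≤ n → f a ≈ g a) → sumTo n f ≈ sumTo n g
  sumTo-cong zero    f≈g = f≈g 0 z≤n
  sumTo-cong (suc n) f≈g =
    +-cong (f≈g (suc n) ℕ.≤-refl) (sumTo-cong n (λ a a≤n → f≈g a (ℕ.m≤n⇒m≤1+n a≤n)))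

  sumTo-zero : ∀ n {f : ℕ → Carrier} → (∀ a → a ≤ n → f a ≈ 0#) → sumTo n f ≈ 0#
  sumTo-zero zero    f≈0 = f≈0 0 z≤n
  sumTo-zero (suc n) f≈0 =
    trans (+-cong (f≈0 (suc n) ℕ.≤-refl) (sumTo-zero n (λ a a≤n → f≈0 a (ℕ.m≤n⇒m≤1+n a≤n))))
          (+-identityˡ 0#)

  sumTo-+ : ∀ n (f g : ℕ → Carrier) → sumTo n (λ a → f a + g a) ≈ sumTo n f + sumTo n g
  sumTo-+ zero    f g = refl
  sumTo-+ (suc n) f g = trans (+-cong refl (sumTo-+ n f g)) (interchange _ _ _ _)

  sumTo-* : ∀ n k (f : ℕ → Carrier) → sumTo n (λ a → k * f a) ≈ k * sumTo n f
  sumTo-* zero    k f = refl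
  sumTo-* (suc n) k f = trans (+-cong refl (sumTo-* n k f)) (sym (distribˡ k _ _))

  sumTo-lower : ∀ n (f : ℕ → Carrier) → sumTo (suc n) f ≈ f 0 + sumTo n (λ a → f (suc a))
  sumTo-lower zero    f = +-comm _ _
  sumTo-lower (suc n) f = trans (+-cong refl (sumTo-lower n f)) (x∙yz≈y∙xz _ _ _)

  sumTo-first : ∀ n (f : ℕ → Carrier) → (∀ a → f (suc a) ≈ 0#) → sumTo n f ≈ f 0
  sumTo-first zero    f rest≈0 = refl
  sumTo-first (suc n) f rest≈0 = trans (+-cong (rest≈0 n) (sumTo-first n f rest≈0)) (+-identityˡ _)

  Σ2 : ℕ → ℕ → (ℕ → ℕ → Carrier) → Carrier
  Σ2 i j t = sumTo i (λ a → sumTo j (λ b → t a b))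

  Σ2-cong : ∀ i j {s t : ℕ → ℕ → Carrier} →
            (∀ a b → a ≤ i → b ≤ j → s a b ≈ t a b) → Σ2 i j s ≈ Σ2 i j t
  Σ2-cong i j s≈t = sumTo-cong i (λ a a≤ → sumTo-cong j (λ b b≤ → s≈t a b a≤ b≤))

  Σ2-zero : ∀ i j {t : ℕ → ℕ → Carrier} → (∀ a b → a ≤ i → b ≤ j → t a b ≈ 0#) → Σ2 i j t ≈ 0#
  Σ2-zero i j t≈0 = sumTo-zero i (λ a a≤ → sumTo-zero j (λ b b≤ → t≈0 a b a≤ b≤))

  Σ2-+ : ∀ i j (s t : ℕ → ℕ → Carrier) → Σ2 i j (λ a b → s a b + t a b) ≈ Σ2 i j s + Σ2 i j t
  Σ2-+ i j s t = trans (sumTo-cong i (λ a _ → sumTo-+ j (s a) (t a))) (sumTo-+ i _ _)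

  Σ2-* : ∀ i j k (t : ℕ → ℕ → Carrier) → Σ2 i j (λ a b → k * t a b) ≈ k * Σ2 i j t
  Σ2-* i j k t = trans (sumTo-cong i (λ a _ → sumTo-* j k (t a))) (sumTo-* i k _)

  ≈ₚ-refl : ∀ {p} → p ≈ₚ p
  ≈ₚ-refl i j = refl

  ≈ₚ-sym : ∀ {p q} → p ≈ₚ q → q ≈ₚ p
  ≈ₚ-sym p≈q i j = sym (p≈q i j)

  ≈ₚ-trans : ∀ {p q r} → p ≈ₚ q → q ≈ₚ r → p ≈ₚ r
  ≈ₚ-trans p≈q q≈r i j = trans (p≈q i j) (q≈r i j)

  Der-setoid : Setoid c ℓ
  Der-setoid = record
    { Carrier = Der
    ; _≈_ = _≈D_
    ; isEquivalence = record
      { refl  = ≈ₚ-refl , ≈ₚ-refl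
      ; sym   = λ (e₁ , e₂) → ≈ₚ-sym e₁ , ≈ₚ-sym e₂
      ; trans = λ (e₁ , e₂) (e₁' , e₂') → ≈ₚ-trans e₁ e₁' , ≈ₚ-trans e₂ e₂'
      }
    }

  *ₚ-cong : ∀ {p p' q q'} → p ≈ₚ p' → q ≈ₚ q' → (p *ₚ q) ≈ₚ (p' *ₚ q')
  *ₚ-cong p≈p' q≈q' i j = Σ2-cong i j (λ a b _ _ → *-cong (p≈p' a b) (q≈q' _ _))

  *ₚ-scalarˡ : ∀ k p q → ((k ·ₚ p) *ₚ q) ≈ₚ (k ·ₚ (p *ₚ q))
  *ₚ-scalarˡ k p q i j = trans (Σ2-cong i j (λ a b _ _ → *-assoc k _ _)) (Σ2-* i j k _)

  *ₚ-scalarʳ : ∀ k p q → (p *ₚ (k ·ₚ q)) ≈ₚ (k ·ₚ (p *ₚ q))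
  *ₚ-scalarʳ k p q i j = trans (Σ2-cong i j (λ a b _ _ → x*yz≈y*xz _ k _)) (Σ2-* i j k _)

  *ₚ-distribʳ : ∀ p q r → ((p +ₚ q) *ₚ r) ≈ₚ ((p *ₚ r) +ₚ (q *ₚ r))
  *ₚ-distribʳ p q r i j = trans (Σ2-cong i j (λ a b _ _ → distribʳ _ _ _)) (Σ2-+ i j _ _)

  *ₚ-distribˡ : ∀ p q r → (p *ₚ (q +ₚ r)) ≈ₚ ((p *ₚ q) +ₚ (p *ₚ r))
  *ₚ-distribˡ p q r i j = trans (Σ2-cong i j (λ a b _ _ → distribˡ _ _ _)) (Σ2-+ i j _ _)

  *ₚ-zeroˡ : ∀ p → (zeroₚ *ₚ p) ≈ₚ zeroₚ
  *ₚ-zeroˡ p i j = Σ2-zero i j (λ a b _ _ → zeroˡ _)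

  *ₚ-identityˡ : ∀ p → (oneₚ *ₚ p) ≈ₚ p
  *ₚ-identityˡ p i j =
    trans (sumTo-first i _ (λ a → sumTo-zero j (λ b _ → zeroˡ _)))
          (trans (sumTo-first j _ (λ b → zeroˡ _)) (*-identityˡ _))

  -- Multiplication by x and by y shifts the coefficients.

  shiftX shiftY : Ser → Ser
  shiftX p zero    j = 0#
  shiftX p (suc i) j = p i j
  shiftY p i zero    = 0#
  shiftY p i (suc j) = p i j

  shiftX-*ˡ : ∀ p q → (shiftX p *ₚ q) ≈ₚ shiftX (p *ₚ q)
  shiftX-*ˡ p q zero    j = sumTo-zero j (λ b _ → zeroˡ _)
  shiftX-*ˡ p q (suc i) j =
    trans (sumTo-lower i _) (trans (+-cong (sumTo-zero j (λ b _ → zeroˡ _)) refl) (+-identityˡ _))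

  shiftY-*ˡ : ∀ p q → (shiftY p *ₚ q) ≈ₚ shiftY (p *ₚ q)
  shiftY-*ˡ p q i zero    = sumTo-zero i (λ a _ → zeroˡ _)
  shiftY-*ˡ p q i (suc j) = sumTo-cong i (λ a _ →
    trans (sumTo-lower j _) (trans (+-cong (zeroˡ _) refl) (+-identityˡ _)))

  shiftX-at-0 : ∀ q n j → shiftX q (n ∸ n) j ≈ 0#
  shiftX-at-0 q n j rewrite ℕ.n∸n≡0 n = refl

  shiftY-at-0 : ∀ q n i → shiftY q i (n ∸ n) ≈ 0#
  shiftY-at-0 q n i rewrite ℕ.n∸n≡0 n = refl

  shiftX-at-suc : ∀ q a i j → a ≤ i → shiftX q (suc i ∸ a) j ≈ q (i ∸ a) j
  shiftX-at-suc q a i j a≤i rewrite ℕ.+-∸-assoc 1 a≤i = refl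

  shiftY-at-suc : ∀ q b i j → b ≤ j → shiftY q i (suc j ∸ b) ≈ q i (j ∸ b)
  shiftY-at-suc q b i j b≤j rewrite ℕ.+-∸-assoc 1 b≤j = refl

  shiftX-*ʳ : ∀ p q → (p *ₚ shiftX q) ≈ₚ shiftX (p *ₚ q)
  shiftX-*ʳ p q zero    j = sumTo-zero j (λ b _ → zeroʳ _)
  shiftX-*ʳ p q (suc i) j =
    trans (+-cong (sumTo-zero j (λ b _ → trans (*-cong refl (shiftX-at-0 q i _)) (zeroʳ _))) refl)
      (trans (+-identityˡ _) (Σ2-cong i j (λ a b a≤ _ → *-cong refl (shiftX-at-suc q a i _ a≤))))

  shiftY-*ʳ : ∀ p q → (p *ₚ shiftY q) ≈ₚ shiftY (p *ₚ q)
  shiftY-*ʳ p q i zero    = sumTo-zero i (λ a _ → zeroʳ _)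
  shiftY-*ʳ p q i (suc j) = sumTo-cong i (λ a _ →
    trans (+-cong (trans (*-cong refl (shiftY-at-0 q j _)) (zeroʳ _)) refl)
      (trans (+-identityˡ _) (sumTo-cong j (λ b b≤ → *-cong refl (shiftY-at-suc q b _ j b≤)))))

  module _ (α : LinForm) where
    private
      a = proj₁ α
      b = proj₂ α
      l = linPoly α

      -- the y-part of l p in the row i: only the term b' = 1 survives
      y-part : ∀ p i j → sumTo j (λ b' → l 0 b' * p i (j ∸ b')) ≈ b * shiftY p i j
      y-part p i zero    = trans (zeroˡ _) (sym (zeroʳ _))
      y-part p i (suc j) = trans (sumTo-lower j _) (trans (+-cong (zeroˡ _) refl)
        (trans (+-identityˡ _) (sumTo-first j _ (λ _ → zeroˡ _))))

    linPoly-*ₚ : ∀ p → (l *ₚ p) ≈ₚ ((a ·ₚ shiftX p) +ₚ (b ·ₚ shiftY p))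
    linPoly-*ₚ p zero j =
      trans (y-part p 0 j) (trans (sym (+-identityˡ _)) (+-cong (sym (zeroʳ a)) refl))
    linPoly-*ₚ p (suc i) j =
      trans (sumTo-lower i _)
        (trans (+-cong (y-part p (suc i) j)
                       (trans (sumTo-first i _ (λ a' → sumTo-zero j (λ _ _ → zeroˡ _)))
                              (sumTo-first j _ (λ _ → zeroˡ _))))
               (+-comm _ _))

    linear-assoc : ∀ p q → ((l *ₚ p) *ₚ q) ≈ₚ (l *ₚ (p *ₚ q))
    linear-assoc p q =
      ≈ₚ-trans (*ₚ-cong (linPoly-*ₚ p) (≈ₚ-refl {q}))
      (≈ₚ-trans (*ₚ-distribʳ (a ·ₚ shiftX p) (b ·ₚ shiftY p) q)
      (≈ₚ-trans (λ i j → +-cong (trans (*ₚ-scalarˡ a (shiftX p) q i j) (*-cong refl (shiftX-*ˡ p q i j)))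
                                (trans (*ₚ-scalarˡ b (shiftY p) q i j) (*-cong refl (shiftY-*ˡ p q i j))))
      (≈ₚ-sym (linPoly-*ₚ (p *ₚ q)))))

    linear-comm : ∀ p q → (p *ₚ (l *ₚ q)) ≈ₚ (l *ₚ (p *ₚ q))
    linear-comm p q =
      ≈ₚ-trans (*ₚ-cong (≈ₚ-refl {p}) (linPoly-*ₚ q))
      (≈ₚ-trans (*ₚ-distribˡ p (a ·ₚ shiftX q) (b ·ₚ shiftY q))
      (≈ₚ-trans (λ i j → +-cong (trans (*ₚ-scalarʳ a p (shiftX q) i j) (*-cong refl (shiftX-*ʳ p q i j)))
                                (trans (*ₚ-scalarʳ b p (shiftY q) i j) (*-cong refl (shiftY-*ʳ p q i j))))
      (≈ₚ-sym (linPoly-*ₚ (p *ₚ q)))))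

  -- K[x,y] has no zero divisors against a nonzero linear form: if l f = 0 then
  -- f = 0, proved coefficient by coefficient using whichever of a, b is nonzero.
  module _ {a b : Carrier} {f : Ser}
           (lf≈0 : ∀ i j → a * shiftX f i j + b * shiftY f i j ≈ 0#) where
    private
      cancel : ∀ {k y} → ¬ k ≈ 0# → k * y ≈ 0# → y ≈ 0#
      cancel {k} {y} k≉0 ky≈0 with inverse k k≉0
      ... | k⁻¹ , kk⁻¹≈1 = begin
        y              ≈⟨ sym (*-identityˡ y) ⟩
        1# * y         ≈⟨ *-cong (sym (trans (*-comm k⁻¹ k) kk⁻¹≈1)) refl ⟩
        (k⁻¹ * k) * y  ≈⟨ *-assoc _ _ _ ⟩
        k⁻¹ * (k * y)  ≈⟨ *-cong refl ky≈0 ⟩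
        k⁻¹ * 0#       ≈⟨ zeroʳ _ ⟩
        0#             ∎

      drop-right : ∀ {u v z} → u + v * z ≈ 0# → z ≈ 0# → u ≈ 0#
      drop-right {u} {v} sum≈0 z≈0 =
        trans (sym (+-identityʳ u)) (trans (+-cong refl (sym (trans (*-cong refl z≈0) (zeroʳ v)))) sum≈0)

    linear-cancel-x : ¬ a ≈ 0# → ∀ j i → f i j ≈ 0#
    linear-cancel-x a≉0 zero    i = cancel a≉0 (drop-right (lf≈0 (suc i) 0) refl)
    linear-cancel-x a≉0 (suc j) i =
      cancel a≉0 (drop-right (lf≈0 (suc i) (suc j)) (linear-cancel-x a≉0 j (suc i)))

    linear-cancel-y : ¬ b ≈ 0# → ∀ i j → f i j ≈ 0#
    linear-cancel-y b≉0 zero    j = cancel b≉0 (drop-right (trans (+-comm _ _) (lf≈0 0 (suc j))) refl)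
    linear-cancel-y b≉0 (suc i) j =
      cancel b≉0 (drop-right (trans (+-comm _ _) (lf≈0 (suc i) (suc j))) (linear-cancel-y b≉0 i (suc j)))

  zero-poly : IsPoly zeroₚ
  zero-poly = 0 , λ _ _ _ → refl

  one-poly : IsPoly oneₚ
  one-poly = 1 , vanish
    where
    vanish : ∀ i j → 1 ≤ i N.+ j → oneₚ i j ≈ 0#
    vanish zero    (suc j) _ = refl
    vanish (suc i) j       _ = refl

  scalar-poly : ∀ k {p} → IsPoly p → IsPoly (k ·ₚ p)
  scalar-poly k (N , p-vanish) = N , λ i j N≤ → trans (*-cong refl (p-vanish i j N≤)) (zeroʳ k)

  linPoly-poly : ∀ α → IsPoly (linPoly α)
  linPoly-poly α = 2 , vanish
    where
    vanish : ∀ i j → 2 ≤ i N.+ j → linPoly α i j ≈ 0#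
    vanish zero          (suc (suc j)) _ = refl
    vanish (suc zero)    (suc j)       _ = refl
    vanish (suc (suc i)) j             _ = refl
    vanish zero          (suc zero)    (s≤s ())
    vanish (suc zero)    zero          (s≤s ())

  split-degree : ∀ {i j a b} → a ≤ i → b ≤ j → i N.+ j ≡ (a N.+ b) N.+ ((i ∸ a) N.+ (j ∸ b))
  split-degree {i} {j} {a} {b} a≤i b≤j =
    ≡.trans (≡.cong₂ N._+_ (≡.sym (ℕ.m+[n∸m]≡n a≤i)) (≡.sym (ℕ.m+[n∸m]≡n b≤j)))
            (ℕ-interchange a (i ∸ a) b (j ∸ b))

  *ₚ-poly : ∀ {p q} → IsPoly p → IsPoly q → IsPoly (p *ₚ q)
  *ₚ-poly {p} {q} (N , p-vanish) (M , q-vanish) = N N.+ M , λ i j le → Σ2-zero i j (term i j le)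
    where
    term : ∀ i j → N N.+ M ≤ i N.+ j → ∀ a b → a ≤ i → b ≤ j → p a b * q (i ∸ a) (j ∸ b) ≈ 0#
    term i j le a b a≤ b≤ with N ℕ.≤? a N.+ b | M ℕ.≤? (i ∸ a) N.+ (j ∸ b)
    ... | yes N≤ | _      = trans (*-cong (p-vanish a b N≤) refl) (zeroˡ _)
    ... | no _   | yes M≤ = trans (*-cong refl (q-vanish _ _ M≤)) (zeroʳ _)
    ... | no N≰  | no M≰  = ⊥-elim (ℕ.<⇒≱ (ℕ.+-mono-< (ℕ.≰⇒> N≰) (ℕ.≰⇒> M≰))
                                   (≡.subst (N N.+ M ≤_) (split-degree a≤ b≤) le))

  homog⇒poly : ∀ {k p} → IsHomog k p → IsPoly p
  homog⇒poly {k} p-homog = suc k , λ i j le → p-homog i j (λ e → ℕ.1+n≰n (≡.subst (suc k ≤_) e le))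

  linPoly-homog : ∀ α → IsHomog 1 (linPoly α)
  linPoly-homog α zero          zero          _  = refl
  linPoly-homog α zero          (suc zero)    ne = ⊥-elim (ne ≡.refl)
  linPoly-homog α zero          (suc (suc j)) _  = refl
  linPoly-homog α (suc zero)    zero          ne = ⊥-elim (ne ≡.refl)
  linPoly-homog α (suc zero)    (suc j)       _  = refl
  linPoly-homog α (suc (suc i)) j             _  = refl

  *ₚ-homog : ∀ {k d p θ} → IsHomog k p → IsHomog d θ → IsHomog (k N.+ d) (p *ₚ θ)
  *ₚ-homog {k} {d} {p} {θ} p-homog θ-homog i j ne = Σ2-zero i j term
    where
    term : ∀ a b → a ≤ i → b ≤ j → p a b * θ (i ∸ a) (j ∸ b) ≈ 0#
    term a b a≤ b≤ with a N.+ b N.≟ k | (i ∸ a) N.+ (j ∸ b) N.≟ d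
    ... | no ≢k  | _      = trans (*-cong (p-homog a b ≢k) refl) (zeroˡ _)
    ... | yes _  | no ≢d  = trans (*-cong refl (θ-homog _ _ ≢d)) (zeroʳ _)
    ... | yes ≡k | yes ≡d = ⊥-elim (ne (≡.trans (split-degree a≤ b≤) (≡.cong₂ N._+_ ≡k ≡d)))

  component : ℕ → Ser → Ser
  component k p a b with a N.+ b N.≟ k
  ... | yes _ = p a b
  ... | no  _ = 0#

  component-homog : ∀ k p → IsHomog k (component k p)
  component-homog k p a b ne with a N.+ b N.≟ k
  ... | yes e = ⊥-elim (ne e)
  ... | no  _ = refl

  component-at : ∀ k p a b → a N.+ b ≡ k → component k p a b ≈ p a b
  component-at k p a b e with a N.+ b N.≟ k
  ... | yes _ = refl
  ... | no ne = ⊥-elim (ne e)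

  product-below-degree : ∀ {d θ} → IsHomog d θ → ∀ f i j → i N.+ j < d → (f *ₚ θ) i j ≈ 0#
  product-below-degree θ-homog f i j lt = Σ2-zero i j (λ a b _ _ →
    trans (*-cong refl (θ-homog _ _ (λ e →
      ℕ.<⇒≢ (ℕ.≤-<-trans (ℕ.+-mono-≤ (ℕ.m∸n≤m i a) (ℕ.m∸n≤m j b)) lt) e)))
      (zeroʳ _))

  product-in-degree : ∀ {d θ} → IsHomog d θ → ∀ k f i j → i N.+ j ≡ k N.+ d →
                      (f *ₚ θ) i j ≈ (component k f *ₚ θ) i j
  product-in-degree {d} {θ} θ-homog k f i j e = Σ2-cong i j term
    where
    term : ∀ a b → a ≤ i → b ≤ j →
           f a b * θ (i ∸ a) (j ∸ b) ≈ component k f a b * θ (i ∸ a) (j ∸ b)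
    term a b a≤ b≤ with (i ∸ a) N.+ (j ∸ b) N.≟ d
    ... | yes ≡d = *-cong (sym (component-at k f a b (ℕ.+-cancelʳ-≡ d _ _
                     (≡.trans (≡.sym (≡.trans (split-degree a≤ b≤) (≡.cong ((a N.+ b) N.+_) ≡d))) e)))) refl
    ... | no  ≢d = trans (*-cong refl (θ-homog _ _ ≢d))
                     (trans (zeroʳ _) (sym (trans (*-cong refl (θ-homog _ _ ≢d)) (zeroʳ _))))

  degree-0-scalar : ∀ {p} → IsHomog 0 p → ∀ θ → (p *ₚ θ) ≈ₚ (p 0 0 ·ₚ θ)
  degree-0-scalar {p} p-homog θ =
    ≈ₚ-trans (*ₚ-cong p≈const (≈ₚ-refl {θ}))
      (≈ₚ-trans (*ₚ-scalarˡ _ oneₚ θ) (λ i j → *-cong refl (*ₚ-identityˡ θ i j)))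
    where
    p≈const : p ≈ₚ (p 0 0 ·ₚ oneₚ)
    p≈const zero    zero    = sym (*-identityʳ _)
    p≈const zero    (suc j) = trans (p-homog _ _ (λ ())) (sym (zeroʳ _))
    p≈const (suc i) j       = trans (p-homog _ _ (λ ())) (sym (zeroʳ _))

  module Truncation {d d' k : ℕ} {θ θ' x : Ser} (f g : Ser)
                    (θ-homog : IsHomog d θ) (θ'-homog : IsHomog d' θ') (x-homog : IsHomog k x)
                    (x≈ : x ≈ₚ ((f *ₚ θ) +ₚ (g *ₚ θ'))) (k<d' : k < d') where

    sees-first-term : ∀ i j → i N.+ j ≡ k → x i j ≈ (f *ₚ θ) i j
    sees-first-term i j ≡k =
      trans (x≈ i j) (trans (+-cong refl
        (product-below-degree θ'-homog g i j (≡.subst (_< d') (≡.sym ≡k) k<d'))) (+-identityʳ _))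

    vanishes-below : k < d → x ≈ₚ zeroₚ
    vanishes-below k<d i j with i N.+ j N.≟ k
    ... | yes ≡k = trans (sees-first-term i j ≡k)
                     (product-below-degree θ-homog f i j (≡.subst (_< d) (≡.sym ≡k) k<d))
    ... | no  ≢k = x-homog i j ≢k

    multiple-above : d ≤ k → x ≈ₚ (component (k ∸ d) f *ₚ θ)
    multiple-above d≤k i j with i N.+ j N.≟ k
    ... | yes ≡k = trans (sees-first-term i j ≡k)
                     (product-in-degree θ-homog (k ∸ d) f i j (≡.trans ≡k (≡.sym (ℕ.m∸n+n≡m d≤k))))
    ... | no  ≢k = trans (x-homog i j ≢k) (sym (*ₚ-homog (component-homog (k ∸ d) f) θ-homog i j
                     (λ e → ≢k (≡.trans e (ℕ.m∸n+n≡m d≤k)))))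

  ⊙-cong : ∀ {p q δ η} → p ≈ₚ q → δ ≈D η → (p ⊙ δ) ≈D (q ⊙ η)
  ⊙-cong p≈q (e₁ , e₂) = *ₚ-cong p≈q e₁ , *ₚ-cong p≈q e₂

  ⊙-identityˡ : ∀ δ → (oneₚ ⊙ δ) ≈D δ
  ⊙-identityˡ (f , g) = *ₚ-identityˡ f , *ₚ-identityˡ g

  ⊙-·D : ∀ p k δ → (p ⊙ (k ·D δ)) ≈D (k ·D (p ⊙ δ))
  ⊙-·D p k (f , g) = *ₚ-scalarʳ k p f , *ₚ-scalarʳ k p g

  ·ₚ-⊙ : ∀ k p δ → ((k ·ₚ p) ⊙ δ) ≈D (k ·D (p ⊙ δ))
  ·ₚ-⊙ k p (f , g) = *ₚ-scalarˡ k p f , *ₚ-scalarˡ k p g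

  ·D-cong : ∀ k {δ η} → δ ≈D η → (k ·D δ) ≈D (k ·D η)
  ·D-cong k (e₁ , e₂) = (λ i j → *-cong refl (e₁ i j)) , (λ i j → *-cong refl (e₂ i j))

  ⊙-linear : ∀ α p δ → (p ⊙ (linPoly α ⊙ δ)) ≈D ((linPoly α *ₚ p) ⊙ δ)
  ⊙-linear α p (f , g) =
    ≈ₚ-trans (linear-comm α p f) (≈ₚ-sym (linear-assoc α p f)) ,
    ≈ₚ-trans (linear-comm α p g) (≈ₚ-sym (linear-assoc α p g))

  apply-⊙ : ∀ p δ β → apply (p ⊙ δ) β ≈ₚ (p *ₚ apply δ β)
  apply-⊙ p (f , g) (a , b) =
    ≈ₚ-sym (≈ₚ-trans (*ₚ-distribˡ p (a ·ₚ f) (b ·ₚ g))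
             (λ i j → +-cong (*ₚ-scalarʳ a p f i j) (*ₚ-scalarʳ b p g i j)))

  ⊙-homog : ∀ {k d p δ} → IsHomog k p → IsHomogDer d δ → IsHomogDer (k N.+ d) (p ⊙ δ)
  ⊙-homog p-homog (f-homog , g-homog) = *ₚ-homog p-homog f-homog , *ₚ-homog p-homog g-homog

  linear-⊙-nonzero : ∀ α → ¬ ((proj₁ α ≈ 0#) × (proj₂ α ≈ 0#)) →
                     ∀ δ → ¬ δ ≈D zeroD → ¬ (linPoly α ⊙ δ) ≈D zeroD
  linear-⊙-nonzero α α≉0 δ δ≉0 (lf≈0 , lg≈0) = a≈0-not-refuted (λ a≈0 → b≈0-not-refuted (λ b≈0 → α≉0 (a≈0 , b≈0)))
    where
    as-shifts : ∀ h → (linPoly α *ₚ h) ≈ₚ zeroₚ →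
                ∀ i j → proj₁ α * shiftX h i j + proj₂ α * shiftY h i j ≈ 0#
    as-shifts h lh≈0 i j = trans (sym (linPoly-*ₚ α h i j)) (lh≈0 i j)
    a≈0-not-refuted : ¬ ¬ (proj₁ α ≈ 0#)
    a≈0-not-refuted a≉0 = δ≉0 ((λ i j → linear-cancel-x (as-shifts (proj₁ δ) lf≈0) a≉0 j i) ,
                               (λ i j → linear-cancel-x (as-shifts (proj₂ δ) lg≈0) a≉0 j i))
    b≈0-not-refuted : ¬ ¬ (proj₂ α ≈ 0#)
    b≈0-not-refuted b≉0 = δ≉0 (linear-cancel-y (as-shifts (proj₁ δ) lf≈0) b≉0 , linear-cancel-y (as-shifts (proj₂ δ) lg≈0) b≉0)

  multiple-scalar-nonzero : ∀ {η θ} k → ¬ η ≈D zeroD → η ≈D (k ·D θ) → ¬ k ≈ 0#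
  multiple-scalar-nonzero k η≉0 (e₁ , e₂) k≈0 =
    η≉0 ((λ i j → trans (e₁ i j) (trans (*-cong k≈0 refl) (zeroˡ _))) ,
         (λ i j → trans (e₂ i j) (trans (*-cong k≈0 refl) (zeroˡ _))))

  invert-multiple : ∀ {η θ} k → ¬ η ≈D zeroD → η ≈D (k ·D θ) →
                    Σ Carrier λ k' → ¬ k' ≈ 0# × θ ≈D (k' ·D η)
  invert-multiple {η} {θ} k η≉0 η≈kθ with inverse k (multiple-scalar-nonzero k η≉0 η≈kθ)
  ... | k⁻¹ , kk⁻¹≈1 = k⁻¹ , k⁻¹≉0 , (solve (proj₁ η≈kθ) , solve (proj₂ η≈kθ))
    where
    k⁻¹≉0 : ¬ k⁻¹ ≈ 0#
    k⁻¹≉0 k⁻¹≈0 = 0≉1 (trans (sym (zeroʳ k)) (trans (*-cong refl (sym k⁻¹≈0)) kk⁻¹≈1))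
    solve : ∀ {u t : Ser} → u ≈ₚ (k ·ₚ t) → t ≈ₚ (k⁻¹ ·ₚ u)
    solve {u} {t} u≈kt i j = begin
      t i j                ≈⟨ sym (*-identityˡ _) ⟩
      1# * t i j           ≈⟨ *-cong (sym (trans (*-comm k⁻¹ k) kk⁻¹≈1)) refl ⟩
      (k⁻¹ * k) * t i j    ≈⟨ *-assoc _ _ _ ⟩
      k⁻¹ * (k * t i j)    ≈⟨ *-cong refl (sym (u≈kt i j)) ⟩
      k⁻¹ * u i j          ∎

  cancel-relation : ∀ f t s → s ≈ₚ (f *ₚ t) → ((((- 1#) ·ₚ f) *ₚ t) +ₚ s) ≈ₚ zeroₚ
  cancel-relation f t s s≈ft i j = begin
    (((- 1#) ·ₚ f) *ₚ t) i j + s i j  ≈⟨ +-cong (*ₚ-scalarˡ (- 1#) f t i j) (s≈ft i j) ⟩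
    - 1# * (f *ₚ t) i j + (f *ₚ t) i j ≈⟨ +-cong (-1*x≈-x _) refl ⟩
    - (f *ₚ t) i j + (f *ₚ t) i j      ≈⟨ -‿inverseˡ _ ⟩
    0#                                 ∎

module Bases {c ℓ : Level} (F : Field c ℓ) {n : ℕ} (A : WithField.Arrangement F n) where
  open Field F
  open WithField F
  open Series F
  open HomBasis

  module _ {μ θ d θ' d'} (B : HomBasis A μ θ d θ' d') where

    basis-nonzero : ¬ θ ≈D zeroD
    basis-nonzero (θ₁≈0 , θ₂≈0) =
      0≉1 (sym (proj₁ (independent B oneₚ zeroₚ one-poly zero-poly
                         (trivial (proj₁ θ') θ₁≈0 , trivial (proj₂ θ') θ₂≈0)) 0 0))
      where
      trivial : ∀ {t} t' → t ≈ₚ zeroₚ → ((oneₚ *ₚ t) +ₚ (zeroₚ *ₚ t')) ≈ₚ zeroₚ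
      trivial {t} t' t≈0 i j =
        trans (+-cong (trans (*ₚ-identityˡ t i j) (t≈0 i j)) (*ₚ-zeroˡ t' i j)) (+-identityʳ _)

    module BelowSecond {δ k} (δ∈D : InD A μ δ) (δ-homog : IsHomogDer k δ) (k<d' : k < d') where
      private
        rep = generates B δ δ∈D
        f = proj₁ rep
        g = proj₁ (proj₂ rep)
        δ≈ = proj₂ (proj₂ (proj₂ (proj₂ rep)))
        module T₁ = Truncation f g (proj₁ (θ-homog B)) (proj₁ (θ'-homog B)) (proj₁ δ-homog) (proj₁ δ≈) k<d'
        module T₂ = Truncation f g (proj₂ (θ-homog B)) (proj₂ (θ'-homog B)) (proj₂ δ-homog) (proj₂ δ≈) k<d'

      vanishes : k < d → δ ≈D zeroD
      vanishes k<d = T₁.vanishes-below k<d , T₂.vanishes-below k<d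

      multiple : d ≤ k → Σ Ser λ P → IsHomog (k ∸ d) P × δ ≈D (P ⊙ θ)
      multiple d≤k = component (k ∸ d) f , component-homog (k ∸ d) f ,
                     (T₁.multiple-above d≤k , T₂.multiple-above d≤k)

    least-degree : d < d' → ∀ {δ k} → InD A μ δ → IsHomogDer k δ → ¬ δ ≈D zeroD → d ≤ k
    least-degree d<d' δ∈D δ-homog δ≉0 = ℕ.≮⇒≥ (λ k<d →
      δ≉0 (BelowSecond.vanishes δ∈D δ-homog (ℕ.<-trans k<d d<d') k<d))

    same-degree-multiple : d < d' → ∀ {δ} → InD A μ δ → IsHomogDer d δ → Σ Carrier λ k → δ ≈D (k ·D θ)
    same-degree-multiple d<d' δ∈D δ-homog
      with BelowSecond.multiple δ∈D δ-homog d<d' ℕ.≤-refl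
    ... | P , P-homog , (e₁ , e₂) =
      P 0 0 , (≈ₚ-trans e₁ (degree-0-scalar P-homog₀ (proj₁ θ)) ,
               ≈ₚ-trans e₂ (degree-0-scalar P-homog₀ (proj₂ θ)))
      where
      P-homog₀ : IsHomog 0 P
      P-homog₀ = ≡.subst (λ m → IsHomog m P) (ℕ.n∸n≡0 d) P-homog

    relation-trivial : ∀ {f g} → IsPoly f → IsPoly g → (g ⊙ θ') ≈D (f ⊙ θ) → g ≈ₚ zeroₚ
    relation-trivial {f} {g} f-poly g-poly (e₁ , e₂) =
      proj₂ (independent B ((- 1#) ·ₚ f) g (scalar-poly (- 1#) f-poly) g-poly
               (cancel-relation f (proj₁ θ) _ e₁ , cancel-relation f (proj₂ θ) _ e₂))

module AddOneAtH {c ℓ : Level} (F : Field c ℓ) {n : ℕ} (A : WithField.Arrangement F n)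
                 (μ ν : Fin n → ℕ) (H : Fin n) (μ≤ν : ∀ K → μ K ≤ ν K)
                 (sum-ν : sumFin n ν ≡ suc (sumFin n μ)) (νH : ν H ≡ suc (μ H)) where
  open Field F
  open WithField F
  open Arrangement A
  open Series F
  open Bases F A
  open HomBasis
  open import Relation.Binary.Reasoning.Setoid Der-setoid

  αH : Ser
  αH = linPoly (α H)

  αH-poly : IsPoly αH
  αH-poly = linPoly-poly (α H)

  private
    νK≡μK : ∀ K → ¬ K ≡ H → ν K ≡ μ K
    νK≡μK = Multiplicities.unchanged-off-H n μ ν H μ≤ν sum-ν νH

    power-cong : ∀ {p q m m'} → m ≡ m' → ((p ^ₚ m) *ₚ q) ≈ₚ ((p ^ₚ m') *ₚ q)
    power-cong ≡.refl = ≈ₚ-refl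

    power-H : ∀ q → ((αH ^ₚ ν H) *ₚ q) ≈ₚ ((αH ^ₚ μ H) *ₚ (αH *ₚ q))
    power-H q = ≈ₚ-trans (power-cong {αH} {q} νH)
                  (≈ₚ-trans (linear-assoc (α H) (αH ^ₚ μ H) q) (≈ₚ-sym (linear-comm (α H) (αH ^ₚ μ H) q)))

  D-ν⊆D-μ : ∀ {δ} → InD A ν δ → InD A μ δ
  D-ν⊆D-μ {δ} (δ-poly , divisible) = δ-poly , divisible'
    where
    divisible' : ∀ K → Σ Ser λ q → IsPoly q × (apply δ (α K) ≈ₚ ((linPoly (α K) ^ₚ μ K) *ₚ q))
    divisible' K with K Fin.≟ H | divisible K
    ... | yes ≡.refl | q , q-poly , e = (αH *ₚ q) , *ₚ-poly αH-poly q-poly , ≈ₚ-trans e (power-H q)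
    ... | no K≢H     | q , q-poly , e = q , q-poly , ≈ₚ-trans e (power-cong {linPoly (α K)} {q} (νK≡μK K K≢H))

  αH-D-μ⊆D-ν : ∀ {δ} → InD A μ δ → InD A ν (αH ⊙ δ)
  αH-D-μ⊆D-ν {δ} ((f-poly , g-poly) , divisible) =
    (*ₚ-poly αH-poly f-poly , *ₚ-poly αH-poly g-poly) , divisible'
    where
    divisible' : ∀ K → Σ Ser λ q → IsPoly q × (apply (αH ⊙ δ) (α K) ≈ₚ ((linPoly (α K) ^ₚ ν K) *ₚ q))
    divisible' K with K Fin.≟ H | divisible K
    ... | yes ≡.refl | q , q-poly , e =
      q , q-poly , ≈ₚ-trans (apply-⊙ αH δ (α H))
                     (≈ₚ-trans (*ₚ-cong (≈ₚ-refl {αH}) e)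
                     (≈ₚ-trans (≈ₚ-sym (linear-assoc (α H) (αH ^ₚ μ H) q))
                     (power-cong {αH} {q} (≡.sym νH))))
    ... | no K≢H     | q , q-poly , e =
      (αH *ₚ q) , *ₚ-poly αH-poly q-poly ,
      ≈ₚ-trans (apply-⊙ αH δ (α K))
        (≈ₚ-trans (*ₚ-cong (≈ₚ-refl {αH}) e)
        (≈ₚ-trans (≈ₚ-sym (linear-comm (α H) (linPoly (α K) ^ₚ μ K) q))
        (power-cong {linPoly (α K)} {αH *ₚ q} (≡.sym (νK≡μK K K≢H)))))

  module Compare {θ θ' η η' : Der} {d d' e e' : ℕ}
                 (Bμ : HomBasis A μ θ d θ' d') (d<d' : d < d')
                 (Bν : HomBasis A ν η e η' e') (e<e' : e < e') where
    private
      αHθ≉0 : ¬ (αH ⊙ θ) ≈D zeroD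
      αHθ≉0 = linear-⊙-nonzero (α H) (nonzero H) θ (basis-nonzero Bμ)

      αH-homog : ∀ {k δ} → IsHomogDer k δ → IsHomogDer (suc k) (αH ⊙ δ)
      αH-homog = ⊙-homog (linPoly-homog (α H))

    -- η ∈ D(A, μ) gives d ≤ e; α_H θ ∈ D(A, ν) gives e ≤ d + 1
    d≤e : d ≤ e
    d≤e = least-degree Bμ d<d' (D-ν⊆D-μ (θ∈D Bν)) (θ-homog Bν) (basis-nonzero Bν)

    e≤1+d : e ≤ suc d
    e≤1+d = least-degree Bν e<e' (αH-D-μ⊆D-ν (θ∈D Bμ)) (αH-homog (θ-homog Bμ)) αHθ≉0

    η-multiple-of-θ : e ≡ d → Σ Carrier λ k → ¬ k ≈ 0# × η ≈D (k ·D θ)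
    η-multiple-of-θ e≡d with same-degree-multiple Bμ d<d' (D-ν⊆D-μ (θ∈D Bν))
                               (≡.subst (λ m → IsHomogDer m η) e≡d (θ-homog Bν))
    ... | k , η≈kθ = k , multiple-scalar-nonzero k (basis-nonzero Bν) η≈kθ , η≈kθ

    η-multiple-of-αHθ : e ≡ suc d → Σ Carrier λ k → ¬ k ≈ 0# × η ≈D (k ·D (αH ⊙ θ))
    η-multiple-of-αHθ e≡1+d with same-degree-multiple Bν e<e' (αH-D-μ⊆D-ν (θ∈D Bμ))
                                   (≡.subst (λ m → IsHomogDer m (αH ⊙ θ)) (≡.sym e≡1+d) (αH-homog (θ-homog Bμ)))
    ... | k , αHθ≈kη = invert-multiple k αHθ≉0 αHθ≈kη

    -- independence of {η, η'}: if θ is a multiple of η, then η' is no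
    -- polynomial multiple of θ
    η'-not-multiple : ∀ k P → IsPoly P → θ ≈D (k ·D η) → ¬ η' ≈D (P ⊙ θ)
    η'-not-multiple k P P-poly θ≈kη η'≈Pθ =
      0≉1 (sym (relation-trivial Bν (scalar-poly k P-poly) one-poly η'-relation 0 0))
      where
      η'-relation : (oneₚ ⊙ η') ≈D ((k ·ₚ P) ⊙ η)
      η'-relation = begin
        oneₚ ⊙ η'         ≈⟨ ⊙-identityˡ η' ⟩
        η'                ≈⟨ η'≈Pθ ⟩
        P ⊙ θ             ≈⟨ ⊙-cong (≈ₚ-refl {P}) θ≈kη ⟩
        P ⊙ (k ·D η)      ≈⟨ ⊙-·D P k η ⟩
        k ·D (P ⊙ η)      ≈⟨ ·ₚ-⊙ k P η ⟨
        (k ·ₚ P) ⊙ η      ∎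

    -- independence of {θ, θ'}: if η is a multiple of α_H θ, then α_H θ' is
    -- no polynomial multiple of η (α_H ≠ 0)
    αHθ'-not-multiple : ∀ k Q → IsPoly Q → η ≈D (k ·D (αH ⊙ θ)) → ¬ (αH ⊙ θ') ≈D (Q ⊙ η)
    αHθ'-not-multiple k Q Q-poly η≈kαHθ αHθ'≈Qη = nonzero H (αH≈0 1 0 , αH≈0 0 1)
      where
      αHθ'-relation : (αH ⊙ θ') ≈D ((k ·ₚ (αH *ₚ Q)) ⊙ θ)
      αHθ'-relation = begin
        αH ⊙ θ'                ≈⟨ αHθ'≈Qη ⟩
        Q ⊙ η                  ≈⟨ ⊙-cong (≈ₚ-refl {Q}) η≈kαHθ ⟩
        Q ⊙ (k ·D (αH ⊙ θ))    ≈⟨ ⊙-·D Q k (αH ⊙ θ) ⟩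
        k ·D (Q ⊙ (αH ⊙ θ))    ≈⟨ ·D-cong k (⊙-linear (α H) Q θ) ⟩
        k ·D ((αH *ₚ Q) ⊙ θ)   ≈⟨ ·ₚ-⊙ k (αH *ₚ Q) θ ⟨
        (k ·ₚ (αH *ₚ Q)) ⊙ θ   ∎
      αH≈0 : αH ≈ₚ zeroₚ
      αH≈0 = relation-trivial Bμ (scalar-poly k (*ₚ-poly αH-poly Q-poly)) αH-poly αHθ'-relation

    -- e = d is impossible when e' < d': θ would be a multiple of η and η' of θ
    e≢d-if-e'<d' : e' < d' → ¬ e ≡ d
    e≢d-if-e'<d' e'<d' e≡d =
      let (k , _ , η≈kθ)  = η-multiple-of-θ e≡d
          (k' , _ , θ≈k'η) = invert-multiple k (basis-nonzero Bν) η≈kθ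
          (P , P-homog , η'≈Pθ) = BelowSecond.multiple Bμ (D-ν⊆D-μ (θ'∈D Bν)) (θ'-homog Bν) e'<d'
                                    (ℕ.≤-trans d≤e (ℕ.<⇒≤ e<e'))
      in η'-not-multiple k' P (homog⇒poly P-homog) θ≈k'η η'≈Pθ

    -- e = d + 1 is impossible when d' + 1 < e': η would be a multiple of α_H θ
    -- and α_H θ' a polynomial multiple of η
    e≢1+d-if-1+d'<e' : suc d' < e' → ¬ e ≡ suc d
    e≢1+d-if-1+d'<e' 1+d'<e' e≡1+d =
      let (k , _ , η≈kαHθ) = η-multiple-of-αHθ e≡1+d
          (Q , Q-homog , αHθ'≈Qη) = BelowSecond.multiple Bν (αH-D-μ⊆D-ν (θ'∈D Bμ)) (αH-homog (θ'-homog Bμ))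
                                      1+d'<e' (≡.subst (_≤ suc d') (≡.sym e≡1+d) (s≤s (ℕ.<⇒≤ d<d')))
      in αHθ'-not-multiple k Q (homog⇒poly Q-homog) η≈kαHθ αHθ'≈Qη

    -- Δ(ν) < Δ(μ): then e' < d', so e ≠ d and hence e = d + 1
    Δ-drops : e' ∸ e < d' ∸ d → Σ Carrier λ k → ¬ k ≈ 0# × η ≈D (k ·D (αH ⊙ θ))
    Δ-drops Δν<Δμ = η-multiple-of-αHθ (ℕ.≤-antisym e≤1+d (ℕ.≤∧≢⇒< d≤e (λ d≡e → e≢d (≡.sym d≡e))))
      where
      e≢d : ¬ e ≡ d
      e≢d e≡d = e≢d-if-e'<d' e'<d' e≡d
        where
        e'<d' : e' < d'
        e'<d' = ℕ.≰⇒> (λ d'≤e' → ℕ.<⇒≱ Δν<Δμ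
                  (≡.subst (λ m → d' ∸ d ≤ e' ∸ m) (≡.sym e≡d) (ℕ.∸-monoˡ-≤ d d'≤e')))

    -- Δ(μ) < Δ(ν): then d' + 1 < e', so e ≠ d + 1 and hence e = d
    Δ-rises : d' ∸ d < e' ∸ e → Σ Carrier λ k → ¬ k ≈ 0# × η ≈D (k ·D θ)
    Δ-rises Δμ<Δν = η-multiple-of-θ (ℕ.≤-antisym (ℕ.≤-pred (ℕ.≤∧≢⇒< e≤1+d e≢1+d)) d≤e)
      where
      e≢1+d : ¬ e ≡ suc d
      e≢1+d e≡1+d = e≢1+d-if-1+d'<e' 1+d'<e' e≡1+d
        where
        1+d'<e' : suc d' < e'
        1+d'<e' = ℕ.≰⇒> (λ e'≤1+d' → ℕ.<⇒≱ Δμ<Δν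
                    (≡.subst (λ m → e' ∸ m ≤ d' ∸ d) (≡.sym e≡1+d) (ℕ.∸-monoˡ-≤ (suc d) e'≤1+d')))

lemma4p3 : {c ℓ : Level} (F : Field c ℓ) {n : ℕ} (A : WithField.Arrangement F n)
    (μ ν : Fin n → ℕ) (H : Fin n) →
    (∀ K → μ K ≤ ν K) → sumFin n ν ≡ suc (sumFin n μ) → ν H ≡ suc (μ H) →
    (θμ θμ' θν θν' : WithField.Der F) (dμ dμ' dν dν' : ℕ) →
    WithField.HomBasis F A μ θμ dμ θμ' dμ' → dμ < dμ' →
    WithField.HomBasis F A ν θν dν θν' dν' → dν < dν' →
    ((dν' ∸ dν < dμ' ∸ dμ) →
      Σ (Field.Carrier F) λ a → ¬ (Field._≈_ F a (Field.0# F)) ×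
        WithField._≈D_ F θν (WithField._·D_ F a
          (WithField._⊙_ F (WithField.linPoly F (WithField.Arrangement.α A H)) θμ)))
    ×
    ((dμ' ∸ dμ < dν' ∸ dν) →
      Σ (Field.Carrier F) λ a → ¬ (Field._≈_ F a (Field.0# F)) ×
        WithField._≈D_ F θν (WithField._·D_ F a θμ))
lemma4p3 F A μ ν H μ≤ν sum-ν νH θμ θμ' θν θν' dμ dμ' dν dν' Bμ dμ<dμ' Bν dν<dν' =
  Δ-drops , Δ-rises
  where
  open AddOneAtH F A μ ν H μ≤ν sum-ν νH
  open Compare Bμ dμ<dμ' Bν dν<dν'
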